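{- Let $r\geq 3$ and $1\leq h\leq r-2$ be integers. Let $\mathcal{G}$ be the edge-labelled path on vertices $t_0,t_1,\dots,t_{r+h}$ with, for each $j=0,\dots,r+h-1$, an edge $\{t_j,t_{j+1}\}$ of label $|j-h|$ (so the labels along the path read $h,h-1,\dots,1,0,1,\dots,h,h+1,h+2,\dots,r-1$). Then $\mathcal{G}$ is a CPR graph and the group it represents is isomorphic to $S_{r+h+1}$.
   Context: A string C-group of rank $r$ is a group $G$ with an ordered sequence $(\rho_0,\dots,\rho_{r-1})$ of involutions generating $G$ such that $(\rho_i\rho_j)^2=1$ whenever $|i-j|\geq2$ and $\langle \rho_i : i\in I\rangle\cap\langle\rho_j : j\in J\rangle=\langle \rho_k : k\in I\cap J\rangle$ for all $I,J\subseteq\{0,\dots,r-1\}$. An edge-labelled multigraph on a finite set $\Omega$ with labels $0,\dots,r-1$, in which each vertex lies on at most one edge of each label and each label occurs, determines involutions $\rho_l\in\mathrm{Sym}(\Omega)$, $\rho_l$ being the product of the transpositions $(a\,b)$ over the edges $\{a,b\}$ of label $l$; the group it represents is $\langle\rho_0,\dots,\rho_{r-1}\rangle$, and the graph is a CPR graph if this group with generating sequence $(\rho_0,\dots,\rho_{r-1})$ is a string C-group. -}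

module Defs where

open import Data.Nat using (ℕ; suc; _+_; _≤_; _<_; ∣_-_∣)
open import Data.Fin using (Fin; toℕ; inject₁; _≟_)
import Data.Fin.Subset
open import Data.Fin.Subset using (Subset; _∩_) renaming (_∈_ to _∈ₛ_)
open import Data.Fin.Permutation using (Permutation′; _⟨$⟩ʳ_; _∘ₚ_)
open import Data.List using (List; []; _∷_; foldr; map; length; filter; allFin)
open import Data.List.Relation.Unary.All using (All)
open import Data.List.Relation.Unary.Any using (Any)
open import Data.Product using (Σ; _×_; _,_; ∃)
open import Data.Sum using (_⊎_)
open import Function using (_∘_; id)
open import Relation.Binary.PropositionalEquality using (_≡_; _≢_)
import Relation.Nullary
open import Relation.Nullary using (¬_; yes; no)
import Data.Nat as ℕ
open import Relation.Nullary.Decidable using (_⊎-dec_; _×-dec_)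

_≈_ : {n : ℕ} → (Fin n → Fin n) → (Fin n → Fin n) → Set
f ≈ g = ∀ x → f x ≡ g x

infix 4 _≈_

swap : {n : ℕ} → Fin n → Fin n → Fin n → Fin n
swap a b x with x ≟ a
... | yes _ = b
... | no _ with x ≟ b
...   | yes _ = a
...   | no _ = x

evalWord : {n r : ℕ} → (Fin r → Fin n → Fin n) → List (Fin r) → Fin n → Fin n
evalWord ρ = foldr (λ i f → ρ i ∘ f) id

-- g ∈ ⟨ ρ i : i ∈ I ⟩.  Since the generators are involutions of a finite
-- set, the subgroup they generate is the set of products of generators.
InSub : {n r : ℕ} → (Fin r → Fin n → Fin n) → Subset r → (Fin n → Fin n) → Set
InSub {n} {r} ρ I g = Σ (List (Fin r)) λ w → All (λ i → i ∈ₛ I) w × (evalWord ρ w ≈ g)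

full : {r : ℕ} → Subset r
full = Data.Fin.Subset.⊤

IsInvolution : {n : ℕ} → (Fin n → Fin n) → Set
IsInvolution f = (f ∘ f ≈ id) × ¬ (f ≈ id)

IsStringCGroup : {n r : ℕ} → (Fin r → Fin n → Fin n) → Set
IsStringCGroup {n} {r} ρ =
    (∀ i → IsInvolution (ρ i))
  × (∀ i j → 2 ≤ ∣ toℕ i - toℕ j ∣ → (ρ i ∘ ρ j) ∘ (ρ i ∘ ρ j) ≈ id)
  × (∀ (I J : Subset r) (g : Fin n → Fin n) →
       ((InSub ρ I g × InSub ρ J g) → InSub ρ (I ∩ J) g)
     × (InSub ρ (I ∩ J) g → (InSub ρ I g × InSub ρ J g)))

Edge : ℕ → Set
Edge n = Fin n × Fin n × ℕ

label : {n : ℕ} → Edge n → ℕ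
label (_ , _ , l) = l

onEdgeWithLabel : {n : ℕ} → ℕ → Fin n → Edge n → Set
onEdgeWithLabel l x (a , b , k) = (k ≡ l) × ((x ≡ a) ⊎ (x ≡ b))

onEdgeWithLabel? : {n : ℕ} (l : ℕ) (x : Fin n) (e : Edge n) →
                   Relation.Nullary.Dec (onEdgeWithLabel l x e)
onEdgeWithLabel? l x (a , b , k) = (k ℕ.≟ l) ×-dec ((x ≟ a) ⊎-dec (x ≟ b))

IsLabelledGraph : (n r : ℕ) → List (Edge n) → Set
IsLabelledGraph n r E =
    All (λ { (a , b , l) → (a ≢ b) × (l < r) }) E
  × (∀ (l : ℕ) (x : Fin n) → length (filter (onEdgeWithLabel? l x) E) ≤ 1)
  × (∀ (l : Fin r) → Any (λ e → label e ≡ toℕ l) E)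

rho : {n r : ℕ} → List (Edge n) → Fin r → Fin n → Fin n
rho E l = foldr (λ { (a , b , k) f → step (k ℕ.≟ toℕ l) a b f }) id E
  where
    step : ∀ {n} {P : Set} → Relation.Nullary.Dec P → Fin n → Fin n →
           (Fin n → Fin n) → Fin n → Fin n
    step (yes _) a b f = swap a b ∘ f
    step (no _)  a b f = f

IsCPRGraph : (n r : ℕ) → List (Edge n) → Set
IsCPRGraph n r E = IsLabelledGraph n r E × IsStringCGroup {n} {r} (rho E)

-- "the group ⟨ρ_0,…,ρ_{r-1}⟩ is isomorphic to S_m":
-- a bijective homomorphism f from Sym(Fin m) onto ⟨ρ⟩.
-- (Note: (σ ∘ₚ τ) ⟨$⟩ʳ x = τ ⟨$⟩ʳ (σ ⟨$⟩ʳ x).)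

IsoToSym : {n r : ℕ} → (Fin r → Fin n → Fin n) → ℕ → Set
IsoToSym {n} {r} ρ m =
  Σ (Permutation′ m → Fin n → Fin n) λ f →
      (∀ σ → InSub ρ full (f σ))
    × (∀ σ τ → f (σ ∘ₚ τ) ≈ f τ ∘ f σ)
    × (∀ σ τ → f σ ≈ f τ → (∀ x → σ ⟨$⟩ʳ x ≡ τ ⟨$⟩ʳ x))
    × (∀ g → InSub ρ full g → Σ (Permutation′ m) λ σ → f σ ≈ g)

pathEdges : (r h : ℕ) → List (Edge (suc (r + h)))
pathEdges r h = map (λ j → (inject₁ j , Data.Fin.suc j , ∣ toℕ j - h ∣)) (allFin (r + h))

{-# OPTIONS --safe #-}

-- The vertices are 0,…,N (N = r + h) and edge {e, e+1} has label |e − h|, so ρ_k is the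
-- adjacent transposition τ_{h+k} when k = 0 or k > h, and τ_{h−k} τ_{h+k} when 1 ≤ k ≤ h.
-- That the ρ_k are involutions and that ρ_i, ρ_j commute for |i − j| ≥ 2 holds in any graph
-- whose edges of one label are pairwise disjoint.
-- For the intersection property, ⟨ρ_i : i ∈ I⟩ is described intrinsically: a permutation
-- belongs to it iff it is admissible, i.e. it moves every vertex inside its I-component and
-- commutes with the reflection v ↦ 2h + 1 − v at the coupled vertices. Generators are
-- admissible, and admissibility is preserved by composition and by intersecting label sets.
-- Conversely, an admissible permutation g without descents g(e+1) < g(e) at I-edges is the
-- identity, and a descent at an edge of label k can be removed by a word in I that increases
-- the weight Σ v·g(v): by ρ_k itself when k labels a single edge, or when some label among
-- k,…,h+1 is missing from I (the mirror image of the descent is then a descent too); otherwise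
-- by τ_e alone, extracted with the braid relation (τ_a τ_b τ_{b+1})³ = τ_a. With I = {0,…,r−1}
-- every permutation is admissible, so the group is all of Sym(r + h + 1).

module Submission where

open import Defs
open import Data.Empty using (⊥-elim)
open import Data.Fin as Fin using (Fin; toℕ; inject₁; fromℕ<)
open import Data.Fin.Permutation using (_⟨$⟩ʳ_; permutation)
import Data.Fin.Properties as Finₚ
open import Data.Fin.Subset using (Subset; _∩_) renaming (_∈_ to _∈ₛ_)
open import Data.Fin.Subset.Properties using (x∈p∩q⁺; x∈p∩q⁻; ∈⊤) renaming (_∈?_ to _∈ₛ?_)
open import Data.List using (List; []; _∷_; _++_; filter; length; reverse)
open import Data.List.Membership.Propositional using (_∈_; find; lose)
open import Data.List.Membership.Propositional.Properties using (∈-map⁺; ∈-allFin)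
open import Data.List.Properties using (filter-none; reverse-involutive; unfold-reverse)
open import Data.List.Relation.Binary.Permutation.Propositional using (↭-sym)
open import Data.List.Relation.Binary.Permutation.Propositional.Properties using (All-resp-↭; ↭-reverse)
open import Data.List.Relation.Unary.All as All using (All; []; _∷_)
open import Data.List.Relation.Unary.All.Properties as Allₚ using (¬Any⇒All¬)
open import Data.List.Relation.Unary.AllPairs as AllPairs using (AllPairs; []; _∷_)
import Data.List.Relation.Unary.AllPairs.Properties as AllPairsₚ
open import Data.List.Relation.Unary.Any using (Any; here; there; any?)
import Data.List.Relation.Unary.Any.Properties as Anyₚ
open import Data.Nat as ℕ using (ℕ; zero; suc; _+_; _*_; _∸_; _≤_; _<_; z≤n; s≤s; z<s; ∣_-_∣; >-nonZero)
open import Data.Nat.Properties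
open import Data.Nat.Tactic.RingSolver using (solve-∀)
open import Data.Product using (Σ; ∃; _×_; _,_; proj₁; proj₂)
open import Data.Sum using (_⊎_; inj₁; inj₂; [_,_]′)
open import Function using (_∘_; id)
open import Function.Bundles using (Injection)
open import Function.Definitions using (Injective)
open import Function.Properties.Inverse using (↔⇒↣)
open import Relation.Binary.PropositionalEquality
open import Relation.Nullary using (¬_; Dec; yes; no)
import Relation.Nullary.Decidable as Dec
open import Relation.Unary using (Decidable)

module _ {n : ℕ} where

  swap-left : (a b : Fin n) → swap a b a ≡ b
  swap-left a b with a Fin.≟ a
  ... | yes _  = refl
  ... | no a≢a = ⊥-elim (a≢a refl)

  swap-right : (a b : Fin n) → swap a b b ≡ a
  swap-right a b with b Fin.≟ a
  ... | yes b≡a = b≡a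
  ... | no _ with b Fin.≟ b
  ...   | yes _  = refl
  ...   | no b≢b = ⊥-elim (b≢b refl)

  swap-fixes : {a b x : Fin n} → x ≢ a → x ≢ b → swap a b x ≡ x
  swap-fixes {a} {b} {x} x≢a x≢b with x Fin.≟ a
  ... | yes x≡a = ⊥-elim (x≢a x≡a)
  ... | no _ with x Fin.≟ b
  ...   | yes x≡b = ⊥-elim (x≢b x≡b)
  ...   | no _    = refl

length-filter≤1 : {A : Set} {P : A → Set} (P? : Decidable P) {xs : List A} →
                  AllPairs (λ x y → P x → ¬ P y) xs → length (filter P? xs) ≤ 1
length-filter≤1 P? {[]} [] = z≤n
length-filter≤1 P? {x ∷ xs} (x≁xs ∷ xs≁) with P? x
... | yes px = ≤-reflexive (cong suc (cong length (filter-none P? (All.map (λ ¬py → ¬py px) x≁xs))))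
... | no _   = length-filter≤1 P? xs≁

-- The involutions of an edge-labelled graph

Loopless : {n : ℕ} → Edge n → Set
Loopless (a , b , _) = a ≢ b

LabelwiseMatching : {n : ℕ} → List (Edge n) → Set
LabelwiseMatching = AllPairs (λ e e′ → ∀ {k x} → onEdgeWithLabel k x e → ¬ onEdgeWithLabel k x e′)

atMostOneEdgeOfEachLabel : ∀ {n} {E : List (Edge n)} → LabelwiseMatching E →
                           ∀ k x → length (filter (onEdgeWithLabel? k x) E) ≤ 1
atMostOneEdgeOfEachLabel matching k x = length-filter≤1 (onEdgeWithLabel? k x) (AllPairs.map (λ apart → apart {k} {x}) matching)

module _ {n r : ℕ} where

  rho-∷-≡ : ∀ {a b k} (E : List (Edge n)) (l : Fin r) x → k ≡ toℕ l →
            rho ((a , b , k) ∷ E) l x ≡ swap a b (rho E l x)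
  rho-∷-≡ {k = k} E l x k≡l with k ℕ.≟ toℕ l
  ... | yes _  = refl
  ... | no k≢l = ⊥-elim (k≢l k≡l)

  rho-∷-≢ : ∀ {a b k} (E : List (Edge n)) (l : Fin r) x → k ≢ toℕ l →
            rho ((a , b , k) ∷ E) l x ≡ rho E l x
  rho-∷-≢ {k = k} E l x k≢l with k ℕ.≟ toℕ l
  ... | yes k≡l = ⊥-elim (k≢l k≡l)
  ... | no _    = refl

  rho-fixes : ∀ {E : List (Edge n)} (l : Fin r) {x} → All (¬_ ∘ onEdgeWithLabel (toℕ l) x) E →
              rho E l x ≡ x
  rho-fixes l [] = refl
  rho-fixes {(a , b , k) ∷ E} l {x} (x∉e ∷ x∉E) = by-label (k ℕ.≟ toℕ l)
    where
    by-label : Dec (k ≡ toℕ l) → rho ((a , b , k) ∷ E) l x ≡ x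
    by-label (no k≢l)  = trans (rho-∷-≢ E l x k≢l) (rho-fixes l x∉E)
    by-label (yes k≡l) = begin
      rho ((a , b , k) ∷ E) l x ≡⟨ rho-∷-≡ E l x k≡l ⟩
      swap a b (rho E l x)      ≡⟨ cong (swap a b) (rho-fixes l x∉E) ⟩
      swap a b x                ≡⟨ swap-fixes (λ x≡a → x∉e (k≡l , inj₁ x≡a)) (λ x≡b → x∉e (k≡l , inj₂ x≡b)) ⟩
      x                         ∎
      where open ≡-Reasoning

  private
    apart-endpoints : ∀ {a b a′ b′ : Fin n} {k k′ x} →
      (∀ {j y} → onEdgeWithLabel j y (a′ , b′ , k′) → ¬ onEdgeWithLabel j y (a , b , k)) →
      k′ ≡ k → x ≡ a ⊎ x ≡ b → x ≢ a′ × x ≢ b′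
    apart-endpoints apart k′≡k x∈ab =
      (λ x≡a′ → apart (k′≡k , inj₁ x≡a′) (refl , x∈ab)) , (λ x≡b′ → apart (k′≡k , inj₂ x≡b′) (refl , x∈ab))

  rho-swaps : ∀ {E : List (Edge n)} {a b} (l : Fin r) → LabelwiseMatching E → (a , b , toℕ l) ∈ E →
              rho E l a ≡ b × rho E l b ≡ a
  rho-swaps {(a , b , _) ∷ E} l (apart ∷ _) (here refl) =
      trans (rho-∷-≡ E l a refl) (trans (cong (swap a b) (rho-fixes l (All.map (λ d → d (refl , inj₁ refl)) apart)))
                                        (swap-left a b))
    , trans (rho-∷-≡ E l b refl) (trans (cong (swap a b) (rho-fixes l (All.map (λ d → d (refl , inj₂ refl)) apart)))
                                        (swap-right a b))
  rho-swaps {(a′ , b′ , k) ∷ E} {a} {b} l (apart ∷ matching) (there ab∈E) = by-label (k ℕ.≟ toℕ l)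
    where
    ab = proj₁ (rho-swaps l matching ab∈E)
    ba = proj₂ (rho-swaps l matching ab∈E)
    by-label : Dec (k ≡ toℕ l) → rho ((a′ , b′ , k) ∷ E) l a ≡ b × rho ((a′ , b′ , k) ∷ E) l b ≡ a
    by-label (no k≢l)  = trans (rho-∷-≢ E l a k≢l) ab , trans (rho-∷-≢ E l b k≢l) ba
    by-label (yes k≡l) =
        trans (rho-∷-≡ E l a k≡l) (trans (cong (swap a′ b′) ab) (fixed (inj₂ refl)))
      , trans (rho-∷-≡ E l b k≡l) (trans (cong (swap a′ b′) ba) (fixed (inj₁ refl)))
      where
      fixed : ∀ {x} → x ≡ a ⊎ x ≡ b → swap a′ b′ x ≡ x
      fixed x∈ab = let x≢a′ , x≢b′ = apart-endpoints (All.lookup apart ab∈E) k≡l x∈ab in swap-fixes x≢a′ x≢b′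

  module _ {E : List (Edge n)} (matching : LabelwiseMatching E) where

    rho-stays-on-edge : (l : Fin r) {x : Fin n} → Any (onEdgeWithLabel (toℕ l) x) E →
                        Any (onEdgeWithLabel (toℕ l) (rho E l x)) E
    rho-stays-on-edge l x∈E with find x∈E
    ... | _ , e∈E , refl , inj₁ refl = lose e∈E (refl , inj₂ (proj₁ (rho-swaps l matching e∈E)))
    ... | _ , e∈E , refl , inj₂ refl = lose e∈E (refl , inj₁ (proj₂ (rho-swaps l matching e∈E)))

    rho-fixes-off-edges : (l : Fin r) {x : Fin n} → ¬ Any (onEdgeWithLabel (toℕ l) x) E → rho E l x ≡ x
    rho-fixes-off-edges l x∉E = rho-fixes l (¬Any⇒All¬ E x∉E)

    rho-involutive : (l : Fin r) (x : Fin n) → rho E l (rho E l x) ≡ x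
    rho-involutive l x with any? (onEdgeWithLabel? (toℕ l) x) E
    ... | no x∉E = trans (cong (rho E l) (rho-fixes-off-edges l x∉E)) (rho-fixes-off-edges l x∉E)
    ... | yes x∈E with find x∈E
    ...   | _ , e∈E , refl , inj₁ refl = let ab , ba = rho-swaps l matching e∈E in trans (cong (rho E l) ab) ba
    ...   | _ , e∈E , refl , inj₂ refl = let ab , ba = rho-swaps l matching e∈E in trans (cong (rho E l) ba) ab

    rho-commute : (i j : Fin r) →
                  (∀ x → Any (onEdgeWithLabel (toℕ i) x) E → ¬ Any (onEdgeWithLabel (toℕ j) x) E) →
                  ∀ x → rho E i (rho E j x) ≡ rho E j (rho E i x)
    rho-commute i j apart x with any? (onEdgeWithLabel? (toℕ j) x) E
    ... | yes x∈j = trans (fixed-by-i (rho-stays-on-edge j x∈j)) (cong (rho E j) (sym (fixed-by-i x∈j)))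
      where
      fixed-by-i : ∀ {y} → Any (onEdgeWithLabel (toℕ j) y) E → rho E i y ≡ y
      fixed-by-i y∈j = rho-fixes-off-edges i (λ y∈i → apart _ y∈i y∈j)
    ... | no x∉j with any? (onEdgeWithLabel? (toℕ i) x) E
    ...   | yes x∈i = trans (cong (rho E i) (fixed-by-j x∈i)) (sym (fixed-by-j (rho-stays-on-edge i x∈i)))
      where
      fixed-by-j : ∀ {y} → Any (onEdgeWithLabel (toℕ i) y) E → rho E j y ≡ y
      fixed-by-j y∈i = rho-fixes-off-edges j (apart _ y∈i)
    ...   | no x∉i = trans (fixes-x i j x∉j x∉i) (sym (fixes-x j i x∉i x∉j))
      where
      fixes-x : ∀ l m → ¬ Any (onEdgeWithLabel (toℕ m) x) E → ¬ Any (onEdgeWithLabel (toℕ l) x) E →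
                rho E l (rho E m x) ≡ x
      fixes-x l m x∉m x∉l = trans (cong (rho E l) (rho-fixes-off-edges m x∉m)) (rho-fixes-off-edges l x∉l)

    rho-not-identity : (l : Fin r) → All Loopless E → Any (λ e → label e ≡ toℕ l) E → ¬ (rho E l ≈ id)
    rho-not-identity l loopless l∈E rho≈id with find l∈E
    ... | (a , b , _) , e∈E , refl =
      All.lookup loopless e∈E (trans (sym (rho≈id a)) (proj₁ (rho-swaps l matching e∈E)))

module _ {n r : ℕ} (ρ : Fin r → Fin n → Fin n) where

  evalWord-++ : ∀ w v x → evalWord ρ (w ++ v) x ≡ evalWord ρ w (evalWord ρ v x)
  evalWord-++ []      v x = refl
  evalWord-++ (i ∷ w) v x = cong (ρ i) (evalWord-++ w v x)

  module _ (ρ-involutive : ∀ l x → ρ l (ρ l x) ≡ x) where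

    evalWord-reverse-inverseˡ : ∀ w x → evalWord ρ (reverse w) (evalWord ρ w x) ≡ x
    evalWord-reverse-inverseˡ []      x = refl
    evalWord-reverse-inverseˡ (i ∷ w) x = begin
      evalWord ρ (reverse (i ∷ w)) (ρ i (evalWord ρ w x))    ≡⟨ cong (λ u → evalWord ρ u (ρ i (evalWord ρ w x))) (unfold-reverse i w) ⟩
      evalWord ρ (reverse w ++ i ∷ []) (ρ i (evalWord ρ w x)) ≡⟨ evalWord-++ (reverse w) (i ∷ []) _ ⟩
      evalWord ρ (reverse w) (ρ i (ρ i (evalWord ρ w x)))    ≡⟨ cong (evalWord ρ (reverse w)) (ρ-involutive i _) ⟩
      evalWord ρ (reverse w) (evalWord ρ w x)                ≡⟨ evalWord-reverse-inverseˡ w x ⟩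
      x                                                      ∎
      where open ≡-Reasoning

    evalWord-reverse-inverseʳ : ∀ w x → evalWord ρ w (evalWord ρ (reverse w) x) ≡ x
    evalWord-reverse-inverseʳ w x =
      trans (cong (λ u → evalWord ρ u (evalWord ρ (reverse w) x)) (sym (reverse-involutive w)))
            (evalWord-reverse-inverseˡ (reverse w) x)

    evalWord-injective : ∀ w {x y} → evalWord ρ w x ≡ evalWord ρ w y → x ≡ y
    evalWord-injective w {x} {y} wx≡wy =
      trans (sym (evalWord-reverse-inverseˡ w x)) (trans (cong (evalWord ρ (reverse w)) wx≡wy) (evalWord-reverse-inverseˡ w y))

    InSub-injective : ∀ {I g} → InSub ρ I g → Injective _≡_ _≡_ g
    InSub-injective (w , _ , w≈g) {x} {y} gx≡gy = evalWord-injective w (trans (w≈g x) (trans gx≡gy (sym (w≈g y))))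

    InSub-cancelʳ : ∀ {I g} w → All (_∈ₛ I) w → InSub ρ I (g ∘ evalWord ρ w) → InSub ρ I g
    InSub-cancelʳ {I} {g} w w∈I (v , v∈I , v≈gw) =
      v ++ reverse w , Allₚ.++⁺ v∈I (All-resp-↭ (↭-sym (↭-reverse w)) w∈I) , λ x → begin
        evalWord ρ (v ++ reverse w) x              ≡⟨ evalWord-++ v (reverse w) x ⟩
        evalWord ρ v (evalWord ρ (reverse w) x)     ≡⟨ v≈gw _ ⟩
        g (evalWord ρ w (evalWord ρ (reverse w) x)) ≡⟨ cong g (evalWord-reverse-inverseʳ w x) ⟩
        g x                                         ∎
      where open ≡-Reasoning

-- Adjacent transpositions of ℕ

opaque
  τ : ℕ → ℕ → ℕ
  τ e v with v ℕ.≟ e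
  ... | yes _ = suc e
  ... | no _ with v ℕ.≟ suc e
  ...   | yes _ = e
  ...   | no _  = v

  τ-left : ∀ e → τ e e ≡ suc e
  τ-left e with e ℕ.≟ e
  ... | yes _  = refl
  ... | no e≢e = ⊥-elim (e≢e refl)

  τ-right : ∀ e → τ e (suc e) ≡ e
  τ-right e with suc e ℕ.≟ e
  ... | yes 1+e≡e = ⊥-elim (1+n≢n 1+e≡e)
  ... | no _ with suc e ℕ.≟ suc e
  ...   | yes _      = refl
  ...   | no 1+e≢1+e = ⊥-elim (1+e≢1+e refl)

  τ-fixes : ∀ {e v} → v ≢ e → v ≢ suc e → τ e v ≡ v
  τ-fixes {e} {v} v≢e v≢1+e with v ℕ.≟ e
  ... | yes v≡e = ⊥-elim (v≢e v≡e)
  ... | no _ with v ℕ.≟ suc e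
  ...   | yes v≡1+e = ⊥-elim (v≢1+e v≡1+e)
  ...   | no _      = refl

τ-fixes-below : ∀ {e v} → v < e → τ e v ≡ v
τ-fixes-below v<e = τ-fixes (<⇒≢ v<e) (<⇒≢ (m<n⇒m<1+n v<e))

τ-fixes-above : ∀ {e v} → suc e < v → τ e v ≡ v
τ-fixes-above 1+e<v = τ-fixes (>⇒≢ (<-trans (n<1+n _) 1+e<v)) (>⇒≢ 1+e<v)

data τ-View (e v : ℕ) : Set where
  at-left   : v ≡ e → τ-View e v
  at-right  : v ≡ suc e → τ-View e v
  elsewhere : v ≢ e → v ≢ suc e → τ-View e v

τ-view : ∀ e v → τ-View e v
τ-view e v with v ℕ.≟ e | v ℕ.≟ suc e
... | yes v≡e | _         = at-left v≡e
... | no _    | yes v≡1+e = at-right v≡1+e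
... | no v≢e  | no v≢1+e  = elsewhere v≢e v≢1+e

τ-involutive : ∀ e v → τ e (τ e v) ≡ v
τ-involutive e v with τ-view e v
... | at-left refl         = trans (cong (τ e) (τ-left e)) (τ-right e)
... | at-right refl        = trans (cong (τ e) (τ-right e)) (τ-left e)
... | elsewhere v≢e v≢1+e = trans (cong (τ e) (τ-fixes v≢e v≢1+e)) (τ-fixes v≢e v≢1+e)

τ-comm : ∀ {a b} → suc (suc a) ≤ b → ∀ v → τ a (τ b v) ≡ τ b (τ a v)
τ-comm {a} {b} a+2≤b v with τ-view a v
... | at-left refl = begin
  τ a (τ b a)    ≡⟨ cong (τ a) (τ-fixes-below (<-trans (n<1+n a) a+2≤b)) ⟩
  τ a a          ≡⟨ τ-left a ⟩
  suc a          ≡⟨ τ-fixes-below a+2≤b ⟨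
  τ b (suc a)    ≡⟨ cong (τ b) (τ-left a) ⟨
  τ b (τ a a)    ∎
  where open ≡-Reasoning
... | at-right refl = begin
  τ a (τ b (suc a)) ≡⟨ cong (τ a) (τ-fixes-below a+2≤b) ⟩
  τ a (suc a)       ≡⟨ τ-right a ⟩
  a                 ≡⟨ τ-fixes-below (<-trans (n<1+n a) a+2≤b) ⟨
  τ b a             ≡⟨ cong (τ b) (τ-right a) ⟨
  τ b (τ a (suc a)) ∎
  where open ≡-Reasoning
... | elsewhere v≢a v≢1+a with τ-view b v
...   | at-left refl = begin
  τ a (τ v v)    ≡⟨ cong (τ a) (τ-left v) ⟩
  τ a (suc v)    ≡⟨ τ-fixes-above (m<n⇒m<1+n a+2≤b) ⟩
  suc v          ≡⟨ τ-left v ⟨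
  τ v v          ≡⟨ cong (τ v) (τ-fixes v≢a v≢1+a) ⟨
  τ v (τ a v)    ∎
  where open ≡-Reasoning
...   | at-right refl = begin
  τ a (τ b (suc b)) ≡⟨ cong (τ a) (τ-right b) ⟩
  τ a b             ≡⟨ τ-fixes-above a+2≤b ⟩
  b                 ≡⟨ τ-right b ⟨
  τ b (suc b)       ≡⟨ cong (τ b) (τ-fixes v≢a v≢1+a) ⟨
  τ b (τ a (suc b)) ∎
  where open ≡-Reasoning
...   | elsewhere v≢b v≢1+b = begin
  τ a (τ b v) ≡⟨ cong (τ a) (τ-fixes v≢b v≢1+b) ⟩
  τ a v       ≡⟨ τ-fixes v≢a v≢1+a ⟩
  v           ≡⟨ τ-fixes v≢b v≢1+b ⟨
  τ b v       ≡⟨ cong (τ b) (τ-fixes v≢a v≢1+a) ⟨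
  τ b (τ a v) ∎
  where open ≡-Reasoning

module 3-cycle (b : ℕ) where

  c : ℕ → ℕ
  c v = τ b (τ (suc b) v)

  c-b : c b ≡ suc b
  c-b = trans (cong (τ b) (τ-fixes-below (n<1+n b))) (τ-left b)

  c-b+1 : c (suc b) ≡ suc (suc b)
  c-b+1 = trans (cong (τ b) (τ-left (suc b))) (τ-fixes-above (n<1+n (suc b)))

  c-b+2 : c (suc (suc b)) ≡ b
  c-b+2 = trans (cong (τ b) (τ-right (suc b))) (τ-right b)

  c³≡id : ∀ v → c (c (c v)) ≡ v
  c³≡id v with τ-view (suc b) v
  ... | at-left refl  = trans (cong (c ∘ c) c-b+1) (trans (cong c c-b+2) c-b)
  ... | at-right refl = trans (cong (c ∘ c) c-b+2) (trans (cong c c-b) c-b+1)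
  ... | elsewhere v≢b+1 v≢b+2 with τ-view b v
  ...   | at-left refl    = trans (cong (c ∘ c) c-b) (trans (cong c c-b+1) c-b+2)
  ...   | at-right v≡b+1  = ⊥-elim (v≢b+1 v≡b+1)
  ...   | elsewhere v≢b _ = trans (cong (c ∘ c) c-v) (trans (cong c c-v) c-v)
    where
    c-v : c v ≡ v
    c-v = trans (cong (τ b) (τ-fixes v≢b+1 v≢b+2)) (τ-fixes v≢b v≢b+1)

τ-braid-cube : ∀ {a b} → suc (suc a) ≤ b → ∀ v →
               let t = λ u → τ a (τ b (τ (suc b) u)) in t (t (t v)) ≡ τ a v
τ-braid-cube {a} {b} a+2≤b v = begin
  τ a (c (τ a (c (τ a (c v))))) ≡⟨ cong (τ a ∘ c ∘ τ a) (c-τa (c v)) ⟩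
  τ a (c (τ a (τ a (c (c v))))) ≡⟨ cong (τ a ∘ c) (τ-involutive a (c (c v))) ⟩
  τ a (c (c (c v)))             ≡⟨ cong (τ a) (3-cycle.c³≡id b v) ⟩
  τ a v                         ∎
  where
  open ≡-Reasoning
  c = λ u → τ b (τ (suc b) u)
  c-τa : ∀ u → c (τ a u) ≡ τ a (c u)
  c-τa u = trans (cong (τ b) (sym (τ-comm (m≤n⇒m≤1+n a+2≤b) u))) (sym (τ-comm a+2≤b (τ (suc b) u)))

τ-reflect : ∀ a b {v} → v ≤ suc (a + b) → τ a (suc (a + b) ∸ v) ≡ suc (a + b) ∸ τ b v
τ-reflect a b {v} v≤m with τ-view b v
... | at-left refl = begin
  τ a (suc (a + v) ∸ v) ≡⟨ cong (τ a) (m+n∸n≡m (suc a) v) ⟩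
  τ a (suc a)           ≡⟨ τ-right a ⟩
  a                     ≡⟨ m+n∸n≡m a v ⟨
  suc (a + v) ∸ suc v   ≡⟨ cong (suc (a + v) ∸_) (τ-left v) ⟨
  suc (a + v) ∸ τ v v   ∎
  where open ≡-Reasoning
... | at-right refl = begin
  τ a (a + b ∸ b)           ≡⟨ cong (τ a) (m+n∸n≡m a b) ⟩
  τ a a                     ≡⟨ τ-left a ⟩
  suc a                     ≡⟨ m+n∸n≡m (suc a) b ⟨
  suc (a + b) ∸ b           ≡⟨ cong (suc (a + b) ∸_) (τ-right b) ⟨
  suc (a + b) ∸ τ b (suc b) ∎
  where open ≡-Reasoning
... | elsewhere v≢b v≢1+b = trans (τ-fixes m∸v≢a m∸v≢1+a) (cong (suc (a + b) ∸_) (sym (τ-fixes v≢b v≢1+b)))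
  where
  v+[m∸v] : ∀ {w} → suc (a + b) ∸ v ≡ w → v + w ≡ suc (a + b)
  v+[m∸v] {w} m∸v≡w = trans (cong (v +_) (sym m∸v≡w)) (m+[n∸m]≡n v≤m)
  m∸v≢a : suc (a + b) ∸ v ≢ a
  m∸v≢a m∸v≡a = v≢1+b (+-cancelʳ-≡ a _ _ (trans (v+[m∸v] m∸v≡a) (cong suc (+-comm a b))))
  m∸v≢1+a : suc (a + b) ∸ v ≢ suc a
  m∸v≢1+a m∸v≡1+a = v≢b (+-cancelʳ-≡ (suc a) _ _ (trans (v+[m∸v] m∸v≡1+a) (trans (cong suc (+-comm a b)) (sym (+-suc b a)))))

τ-≤ : ∀ {m a v} → v ≤ m → suc a ≤ m → τ a v ≤ m
τ-≤ {m} {a} {v} v≤m a<m with τ-view a v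
... | at-left refl          = ≤-trans (≤-reflexive (τ-left a)) a<m
... | at-right refl         = ≤-trans (≤-reflexive (τ-right a)) (<⇒≤ a<m)
... | elsewhere v≢a v≢1+a   = ≤-trans (≤-reflexive (τ-fixes v≢a v≢1+a)) v≤m

-- Weights

sumBelow : ℕ → (ℕ → ℕ) → ℕ
sumBelow zero    F = 0
sumBelow (suc n) F = sumBelow n F + F n

sumBelow-cong : ∀ n {F G : ℕ → ℕ} → (∀ v → v < n → F v ≡ G v) → sumBelow n F ≡ sumBelow n G
sumBelow-cong zero    F≗G = refl
sumBelow-cong (suc n) F≗G = cong₂ _+_ (sumBelow-cong n (λ v v<n → F≗G v (m<n⇒m<1+n v<n))) (F≗G n ≤-refl)

sumBelow-≤ : ∀ n {F : ℕ → ℕ} {B} → (∀ v → v < n → F v ≤ B) → sumBelow n F ≤ n * B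
sumBelow-≤ zero    F≤B = z≤n
sumBelow-≤ (suc n) {F} {B} F≤B = begin
  sumBelow n F + F n ≤⟨ +-mono-≤ (sumBelow-≤ n (λ v v<n → F≤B v (m<n⇒m<1+n v<n))) (F≤B n ≤-refl) ⟩
  n * B + B          ≡⟨ +-comm (n * B) B ⟩
  suc n * B          ∎
  where open ≤-Reasoning

sumBelow-update : ∀ n {F G : ℕ → ℕ} e → suc e < n → (∀ v → v ≢ e → v ≢ suc e → F v ≡ G v) →
                  sumBelow n F + (G e + G (suc e)) ≡ sumBelow n G + (F e + F (suc e))
sumBelow-update (suc m) {F} {G} e e+1<n F≗G with m≤n⇒m<n∨m≡n (≤-pred e+1<n)
... | inj₂ refl = begin
  sumBelow e F + F e + F (suc e) + (G e + G (suc e)) ≡⟨ cong (λ s → s + F e + F (suc e) + (G e + G (suc e))) below-e ⟩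
  sumBelow e G + F e + F (suc e) + (G e + G (suc e)) ≡⟨ regroup (sumBelow e G) (F e) (F (suc e)) (G e) (G (suc e)) ⟩
  sumBelow e G + G e + G (suc e) + (F e + F (suc e)) ∎
  where
  open ≡-Reasoning
  below-e : sumBelow e F ≡ sumBelow e G
  below-e = sumBelow-cong e (λ v v<e → F≗G v (<⇒≢ v<e) (<⇒≢ (m<n⇒m<1+n v<e)))
  regroup : ∀ s a b c d → s + a + b + (c + d) ≡ s + c + d + (a + b)
  regroup = solve-∀
... | inj₁ e+1<m = begin
  sumBelow m F + F m + (G e + G (suc e)) ≡⟨ swap-last (sumBelow m F) (F m) _ ⟩
  sumBelow m F + (G e + G (suc e)) + F m ≡⟨ cong₂ _+_ (sumBelow-update m e e+1<m F≗G) (F≗G m m≢e m≢e+1) ⟩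
  sumBelow m G + (F e + F (suc e)) + G m ≡⟨ swap-last (sumBelow m G) (G m) _ ⟨
  sumBelow m G + G m + (F e + F (suc e)) ∎
  where
  open ≡-Reasoning
  m≢e : m ≢ e
  m≢e = >⇒≢ (<-trans (n<1+n e) e+1<m)
  m≢e+1 : m ≢ suc e
  m≢e+1 = >⇒≢ e+1<m
  swap-last : ∀ s x y → s + x + y ≡ s + y + x
  swap-last = solve-∀

weight : ℕ → (ℕ → ℕ) → ℕ
weight n G = sumBelow n (λ v → v * G v)

weight-τ : ∀ n (G : ℕ → ℕ) e → suc e < n → G (suc e) < G e → weight n G < weight n (G ∘ τ e)
weight-τ n G e e+1<n descent = +-cancelʳ-< (K + b) (weight n G) (weight n (G ∘ τ e)) (begin-strict
  weight n G + (K + b)              <⟨ +-monoʳ-< (weight n G) (+-monoʳ-< K descent) ⟩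
  weight n G + (K + a)              ≡⟨ cong (weight n G +_) (rearrange-a e a b) ⟨
  weight n G + (e * b + suc e * a)  ≡⟨ cong (λ s → weight n G + (s + suc e * a)) (cong (e *_) (cong G (τ-left e))) ⟨
  weight n G + (e * G (τ e e) + suc e * a)
                                    ≡⟨ cong (λ s → weight n G + (e * G (τ e e) + suc e * s)) (cong G (τ-right e)) ⟨
  weight n G + (e * G (τ e e) + suc e * G (τ e (suc e)))
                                    ≡⟨ sumBelow-update n e e+1<n (λ v v≢e v≢e+1 → cong ((v *_) ∘ G) (sym (τ-fixes v≢e v≢e+1))) ⟩
  weight n (G ∘ τ e) + (e * a + suc e * b) ≡⟨ cong (weight n (G ∘ τ e) +_) (rearrange-b e a b) ⟩
  weight n (G ∘ τ e) + (K + b)      ∎)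
  where
  open ≤-Reasoning
  a = G e
  b = G (suc e)
  K = e * a + e * b
  rearrange-a : ∀ e a b → e * b + suc e * a ≡ (e * a + e * b) + a
  rearrange-a = solve-∀
  rearrange-b : ∀ e a b → e * a + suc e * b ≡ (e * a + e * b) + b
  rearrange-b = solve-∀

∣1+m-m∣≡1 : ∀ m → ∣ suc m - m ∣ ≡ 1
∣1+m-m∣≡1 zero    = refl
∣1+m-m∣≡1 (suc m) = ∣1+m-m∣≡1 m

∣m-1+m∣≡1 : ∀ m → ∣ m - suc m ∣ ≡ 1
∣m-1+m∣≡1 m = trans (∣-∣-comm m (suc m)) (∣1+m-m∣≡1 m)

∣∣1+v-h∣-∣v-h∣∣≡1 : ∀ v h → ∣ ∣ suc v - h ∣ - ∣ v - h ∣ ∣ ≡ 1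
∣∣1+v-h∣-∣v-h∣∣≡1 v       zero    = trans (cong ∣_- ∣ v - 0 ∣ ∣ (∣-∣-identityʳ (suc v)))
                                    (trans (cong ∣ suc v -_∣ (∣-∣-identityʳ v)) (∣1+m-m∣≡1 v))
∣∣1+v-h∣-∣v-h∣∣≡1 zero    (suc h) = ∣m-1+m∣≡1 h
∣∣1+v-h∣-∣v-h∣∣≡1 (suc v) (suc h) = ∣∣1+v-h∣-∣v-h∣∣≡1 v h

∣v-h∣≡k⇒v≡h+k⊎v+k≡h : ∀ v h {k} → ∣ v - h ∣ ≡ k → v ≡ h + k ⊎ v + k ≡ h
∣v-h∣≡k⇒v≡h+k⊎v+k≡h zero    h       refl = inj₂ refl
∣v-h∣≡k⇒v≡h+k⊎v+k≡h (suc v) zero    refl = inj₁ refl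
∣v-h∣≡k⇒v≡h+k⊎v+k≡h (suc v) (suc h) eq with ∣v-h∣≡k⇒v≡h+k⊎v+k≡h v h eq
... | inj₁ v≡h+k = inj₁ (cong suc v≡h+k)
... | inj₂ v+k≡h = inj₂ (cong suc v+k≡h)

-- The path graph

module Path (r h : ℕ) (h+2≤r : suc (suc h) ≤ r) where

  N n M : ℕ
  N = r + h
  n = suc N
  M = suc (h + h)

  ρ : Fin r → Fin n → Fin n
  ρ = rho (pathEdges r h)

  lab : ℕ → ℕ
  lab v = ∣ v - h ∣

  lab-h+ : ∀ k → lab (h + k) ≡ k
  lab-h+ k = trans (∣-∣-comm (h + k) h) (∣m-m+n∣≡n h k)

  lab-∸ : ∀ {k} → k ≤ h → lab (h ∸ k) ≡ k
  lab-∸ {k} k≤h = trans (cong (λ x → ∣ h ∸ k - x ∣) (sym (m∸n+n≡m k≤h))) (∣m-m+n∣≡n (h ∸ k) k)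

  lab-inverse : ∀ {v k} → lab v ≡ k → v ≡ h + k ⊎ v + k ≡ h
  lab-inverse {v} = ∣v-h∣≡k⇒v≡h+k⊎v+k≡h v h

  lab-reflect : ∀ {e} → e ≤ h + h → lab (h + h ∸ e) ≡ lab e
  lab-reflect {e} e≤2h with lab-inverse {e} refl
  ... | inj₁ e≡h+k = begin
    lab (h + h ∸ e)           ≡⟨ cong (λ x → lab (h + h ∸ x)) e≡h+k ⟩
    lab (h + h ∸ (h + lab e)) ≡⟨ cong lab ([m+n]∸[m+o]≡n∸o h h (lab e)) ⟩
    lab (h ∸ lab e)           ≡⟨ lab-∸ (+-cancelˡ-≤ h _ _ (≤-trans (≤-reflexive (sym e≡h+k)) e≤2h)) ⟩
    lab e                     ∎
    where open ≡-Reasoning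
  ... | inj₂ e+k≡h = begin
    lab (h + h ∸ e)               ≡⟨ cong (λ x → lab (x + h ∸ e)) e+k≡h ⟨
    lab (e + lab e + h ∸ e)       ≡⟨ cong (λ x → lab (x ∸ e)) (+-assoc e (lab e) h) ⟩
    lab (e + (lab e + h) ∸ e)     ≡⟨ cong lab (m+n∸m≡n e (lab e + h)) ⟩
    lab (lab e + h)               ≡⟨ cong lab (+-comm (lab e) h) ⟩
    lab (h + lab e)               ≡⟨ lab-h+ (lab e) ⟩
    lab e                         ∎
    where open ≡-Reasoning

  h<r : h < r
  h<r = <-trans (n<1+n h) h+2≤r

  h<N : h < N
  h<N = <-≤-trans h<r (m≤m+n r h)

  M<N : M < N
  M<N = begin-strict
    suc (h + h)       ≡⟨ +-suc h h ⟨
    h + suc h         <⟨ +-monoʳ-< h h+2≤r ⟩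
    h + r             ≡⟨ +-comm h r ⟩
    r + h             ∎
    where open ≤-Reasoning

  h+k<N : ∀ {k} → k < r → h + k < N
  h+k<N {k} k<r = ≤-trans (+-monoʳ-< h k<r) (≤-reflexive (+-comm h r))

  lab<r : ∀ {v} → v < N → lab v < r
  lab<r {v} v<N with lab-inverse {v} refl
  ... | inj₁ v≡h+k = +-cancelˡ-< h _ _ (≤-trans (≤-reflexive (cong suc (sym v≡h+k))) (≤-trans v<N (≤-reflexive (+-comm r h))))
  ... | inj₂ v+k≡h = ≤-<-trans (≤-trans (m≤n+m (lab v) v) (≤-reflexive v+k≡h)) h<r

  lab<r⇒<N : ∀ {v} → lab v < r → v < N
  lab<r⇒<N {v} k<r with lab-inverse {v} refl
  ... | inj₁ v≡h+k = ≤-trans (≤-reflexive (cong suc v≡h+k)) (h+k<N k<r)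
  ... | inj₂ v+k≡h = ≤-<-trans (≤-trans (m≤m+n v (lab v)) (≤-reflexive v+k≡h)) h<N

  edge : Fin N → Edge n
  edge j = (inject₁ j , Fin.suc j , lab (toℕ j))

  edge∈path : ∀ j → edge j ∈ pathEdges r h
  edge∈path j = ∈-map⁺ _ (∈-allFin j)

  on-edge : ∀ {k x} j → onEdgeWithLabel k x (edge j) →
            lab (toℕ j) ≡ k × (toℕ x ≡ toℕ j ⊎ toℕ x ≡ suc (toℕ j))
  on-edge j (refl , inj₁ refl) = refl , inj₁ (Finₚ.toℕ-inject₁ j)
  on-edge j (refl , inj₂ refl) = refl , inj₂ refl

  on-path : ∀ {k x} → Any (onEdgeWithLabel k x) (pathEdges r h) →
            ∃ λ e → lab e ≡ k × (toℕ x ≡ e ⊎ toℕ x ≡ suc e)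
  on-path x∈E with find (Anyₚ.map⁻ x∈E)
  ... | j , _ , x∈j = toℕ j , on-edge j x∈j

  shared-vertex : ∀ {v i j} → v ≡ i ⊎ v ≡ suc i → v ≡ j ⊎ v ≡ suc j → i ≡ j ⊎ ∣ lab i - lab j ∣ ≡ 1
  shared-vertex         (inj₁ refl) (inj₁ refl) = inj₁ refl
  shared-vertex         (inj₂ refl) (inj₂ refl) = inj₁ refl
  shared-vertex {j = j} (inj₁ refl) (inj₂ refl) = inj₂ (∣∣1+v-h∣-∣v-h∣∣≡1 j h)
  shared-vertex {i = i} (inj₂ refl) (inj₁ refl) = inj₂ (trans (∣-∣-comm (lab i) _) (∣∣1+v-h∣-∣v-h∣∣≡1 i h))

  path-matching : LabelwiseMatching (pathEdges r h)
  path-matching = AllPairsₚ.map⁺ (AllPairsₚ.tabulate⁺ apart)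
    where
    apart : ∀ {i j} → i ≢ j → ∀ {k x} → onEdgeWithLabel k x (edge i) → ¬ onEdgeWithLabel k x (edge j)
    apart {i} {j} i≢j x∈i x∈j with on-edge i x∈i | on-edge j x∈j
    ... | i:k , x∼i | j:k , x∼j with shared-vertex x∼i x∼j
    ...   | inj₁ i≡j = i≢j (Finₚ.toℕ-injective i≡j)
    ...   | inj₂ ∣i-j∣≡1 = 0≢1+n (trans (sym (m≡n⇒∣m-n∣≡0 (trans i:k (sym j:k)))) ∣i-j∣≡1)

  path-loopless : All Loopless (pathEdges r h)
  path-loopless = Allₚ.map⁺ (Allₚ.tabulate⁺ inject₁≢suc)
    where
    inject₁≢suc : (j : Fin N) → inject₁ j ≢ Fin.suc j
    inject₁≢suc j eq = 1+n≢n (sym (trans (sym (Finₚ.toℕ-inject₁ j)) (cong toℕ eq)))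

  every-label-occurs : ∀ (l : Fin r) → Any (λ e → label e ≡ toℕ l) (pathEdges r h)
  every-label-occurs l = Anyₚ.map⁺ (Anyₚ.tabulate⁺ j (trans (cong lab (Finₚ.toℕ-fromℕ< h+l<N)) (lab-h+ (toℕ l))))
    where
    h+l<N = h+k<N (Finₚ.toℕ<n l)
    j = fromℕ< h+l<N

  path-isLabelledGraph : IsLabelledGraph n r (pathEdges r h)
  path-isLabelledGraph =
      Allₚ.map⁺ (Allₚ.tabulate⁺ (λ j → All.lookup path-loopless (edge∈path j) , lab<r (Finₚ.toℕ<n j)))
    , atMostOneEdgeOfEachLabel path-matching
    , every-label-occurs

  far-labels-apart : (i j : Fin r) → 2 ≤ ∣ toℕ i - toℕ j ∣ → ∀ x →
                     Any (onEdgeWithLabel (toℕ i) x) (pathEdges r h) → ¬ Any (onEdgeWithLabel (toℕ j) x) (pathEdges r h)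
  far-labels-apart i j 2≤∣i-j∣ x x∈i x∈j with on-path x∈i | on-path x∈j
  ... | e , e:i , x∼e | f , f:j , x∼f with shared-vertex x∼e x∼f
  ...   | inj₁ refl = <⇒≱ (s≤s z≤n) (≤-trans 2≤∣i-j∣ (≤-reflexive (m≡n⇒∣m-n∣≡0 (trans (sym e:i) f:j))))
  ...   | inj₂ ∣e-f∣≡1 = <⇒≱ (s≤s (s≤s z≤n)) (≤-trans 2≤∣i-j∣ (≤-reflexive (trans (cong₂ ∣_-_∣ (sym e:i) (sym f:j)) ∣e-f∣≡1)))

  ρ-involutive : ∀ l (x : Fin n) → ρ l (ρ l x) ≡ x
  ρ-involutive = rho-involutive path-matching

  ρ-isInvolution : ∀ l → IsInvolution (ρ l)
  ρ-isInvolution l = ρ-involutive l , rho-not-identity path-matching l path-loopless (every-label-occurs l)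

  ρ-far-commute : (i j : Fin r) → 2 ≤ ∣ toℕ i - toℕ j ∣ → (ρ i ∘ ρ j) ∘ (ρ i ∘ ρ j) ≈ id
  ρ-far-commute i j 2≤∣i-j∣ x = begin
    ρ i (ρ j (ρ i (ρ j x))) ≡⟨ cong (ρ i) (rho-commute path-matching j i (far-labels-apart j i 2≤∣j-i∣) (ρ j x)) ⟩
    ρ i (ρ i (ρ j (ρ j x))) ≡⟨ ρ-involutive i _ ⟩
    ρ j (ρ j x)             ≡⟨ ρ-involutive j x ⟩
    x                       ∎
    where
    open ≡-Reasoning
    2≤∣j-i∣ = ≤-trans 2≤∣i-j∣ (≤-reflexive (∣-∣-comm (toℕ i) (toℕ j)))

  data Kind (k : ℕ) : Set where
    single : k ≡ 0 ⊎ h < k → Kind k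
    paired : 1 ≤ k → k ≤ h → Kind k

  kind : ∀ k → Kind k
  kind zero = single (inj₁ refl)
  kind (suc k) with suc k ℕ.≤? h
  ... | yes k<h = paired (s≤s z≤n) k<h
  ... | no  k≮h = single (inj₂ (≰⇒> k≮h))

  act : ∀ {k} → Kind k → ℕ → ℕ
  act {k} (single _)   = τ (h + k)
  act {k} (paired _ _) = τ (h ∸ k) ∘ τ (h + k)

  single-edge : ∀ {k e} → k ≡ 0 ⊎ h < k → lab e ≡ k → e ≡ h + k
  single-edge k≡0⊎h<k e:k with lab-inverse e:k | k≡0⊎h<k
  ... | inj₁ e≡h+k | _        = e≡h+k
  ... | inj₂ e+k≡h | inj₁ refl = trans (sym (+-identityʳ _)) (trans e+k≡h (sym (+-identityʳ h)))
  ... | inj₂ e+k≡h | inj₂ h<k  = ⊥-elim (<⇒≱ h<k (≤-trans (m≤n+m _ _) (≤-reflexive e+k≡h)))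

  module Paired {k} (1≤k : 1 ≤ k) (k≤h : k ≤ h) where

    a b : ℕ
    a = h ∸ k
    b = h + k

    a+k≡h : a + k ≡ h
    a+k≡h = m∸n+n≡m k≤h

    a<h : a < h
    a<h = ≤-trans (≤-reflexive (+-comm 1 a)) (≤-trans (+-monoʳ-≤ a 1≤k) (≤-reflexive a+k≡h))

    h<b : h < b
    h<b = ≤-trans (≤-reflexive (+-comm 1 h)) (+-monoʳ-≤ h 1≤k)

    a+2≤b : suc (suc a) ≤ b
    a+2≤b = ≤-trans (s≤s a<h) h<b

    a+b≡h+h : a + b ≡ h + h
    a+b≡h+h = begin
      a + (h + k) ≡⟨ cong (a +_) (+-comm h k) ⟩
      a + (k + h) ≡⟨ +-assoc a k h ⟨
      a + k + h   ≡⟨ cong (_+ h) a+k≡h ⟩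
      h + h       ∎
      where open ≡-Reasoning

    lab-a : lab a ≡ k
    lab-a = lab-∸ k≤h

    lab-b : lab b ≡ k
    lab-b = lab-h+ k

    edges : ∀ {e} → lab e ≡ k → e ≡ b ⊎ e ≡ a
    edges {e} e:k with lab-inverse e:k
    ... | inj₁ e≡b   = inj₁ e≡b
    ... | inj₂ e+k≡h = inj₂ (trans (sym (m+n∸n≡m e k)) (cong (_∸ k) e+k≡h))

  act-swaps-edge : ∀ {k e} (κ : Kind k) → lab e ≡ k → act κ e ≡ suc e × act κ (suc e) ≡ e
  act-swaps-edge {e = e} (single k≡0⊎h<k) e:k with single-edge {e = e} k≡0⊎h<k e:k
  ... | refl = τ-left _ , τ-right _
  act-swaps-edge {e = e} (paired 1≤k k≤h) e:k with Paired.edges 1≤k k≤h {e} e:k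
  ... | inj₁ refl = trans (cong (τ a) (τ-left b)) (τ-fixes-above (s≤s (<-trans (n<1+n _) a+2≤b)))
                  , trans (cong (τ a) (τ-right b)) (τ-fixes-above a+2≤b)
    where open Paired 1≤k k≤h
  ... | inj₂ refl = trans (cong (τ a) (τ-fixes-below (<-trans (n<1+n a) a+2≤b))) (τ-left a)
                  , trans (cong (τ a) (τ-fixes-below a+2≤b)) (τ-right a)
    where open Paired 1≤k k≤h

  OffEdges : ℕ → ℕ → Set
  OffEdges k v = ∀ e → lab e ≡ k → v ≢ e × v ≢ suc e

  act-fixes : ∀ {k v} (κ : Kind k) → OffEdges k v → act κ v ≡ v
  act-fixes {k} (single _) off = let v≢e , v≢e+1 = off (h + k) (lab-h+ k) in τ-fixes v≢e v≢e+1
  act-fixes {k} {v} (paired 1≤k k≤h) off = begin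
    τ a (τ b v) ≡⟨ cong (τ a) (τ-fixes v≢b v≢b+1) ⟩
    τ a v       ≡⟨ τ-fixes v≢a v≢a+1 ⟩
    v           ∎
    where
    open ≡-Reasoning
    open Paired 1≤k k≤h
    v≢a = proj₁ (off a lab-a)
    v≢a+1 = proj₂ (off a lab-a)
    v≢b = proj₁ (off b lab-b)
    v≢b+1 = proj₂ (off b lab-b)

  data EdgeView (k v : ℕ) : Set where
    lower : lab v ≡ k → EdgeView k v
    upper : ∀ {u} → v ≡ suc u → lab u ≡ k → EdgeView k v
    off   : OffEdges k v → EdgeView k v

  edge-view : ∀ k v → EdgeView k v
  edge-view k v with lab v ℕ.≟ k
  edge-view k v       | yes v:k = lower v:k
  edge-view k zero    | no v≁k = off (λ e e:k → (λ 0≡e → v≁k (trans (cong lab 0≡e) e:k)) , λ ())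
  edge-view k (suc u) | no v≁k with lab u ℕ.≟ k
  ... | yes u:k = upper refl u:k
  ... | no  u≁k = off (λ e e:k → (λ v≡e → v≁k (trans (cong lab v≡e) e:k))
                               , (λ v≡e+1 → u≁k (trans (cong lab (suc-injective v≡e+1)) e:k)))

  ρ-swaps-edge : ∀ (j : Fin N) {l} → lab (toℕ j) ≡ toℕ l → ρ l (inject₁ j) ≡ Fin.suc j × ρ l (Fin.suc j) ≡ inject₁ j
  ρ-swaps-edge j {l} j:l = rho-swaps l path-matching (subst (λ k → (inject₁ j , Fin.suc j , k) ∈ pathEdges r h) j:l (edge∈path j))

  ActsAs : (Fin n → Fin n) → (ℕ → ℕ) → Set
  ActsAs f F = ∀ x → toℕ (f x) ≡ F (toℕ x)

  ρ-actsAs : ∀ {k} l → toℕ l ≡ k → (κ : Kind k) → ActsAs (ρ l) (act κ)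
  ρ-actsAs l refl κ x with edge-view (toℕ l) (toℕ x)
  ... | lower x:l = begin
    toℕ (ρ l x)           ≡⟨ cong (toℕ ∘ ρ l) x≡j ⟨
    toℕ (ρ l (inject₁ j)) ≡⟨ cong toℕ (proj₁ (ρ-swaps-edge j (trans (cong lab (Finₚ.toℕ-fromℕ< x<N)) x:l))) ⟩
    suc (toℕ j)           ≡⟨ cong suc (Finₚ.toℕ-fromℕ< x<N) ⟩
    suc (toℕ x)           ≡⟨ proj₁ (act-swaps-edge κ x:l) ⟨
    act κ (toℕ x)         ∎
    where
    open ≡-Reasoning
    x<N = lab<r⇒<N (≤-trans (≤-reflexive (cong suc x:l)) (Finₚ.toℕ<n l))
    j = fromℕ< x<N
    x≡j : inject₁ j ≡ x
    x≡j = Finₚ.toℕ-injective (trans (Finₚ.toℕ-inject₁ j) (Finₚ.toℕ-fromℕ< x<N))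
  ρ-actsAs l refl κ (Fin.suc j) | upper refl j:l =
    trans (cong toℕ (proj₂ (ρ-swaps-edge j j:l))) (trans (Finₚ.toℕ-inject₁ j) (sym (proj₂ (act-swaps-edge κ j:l))))
  ρ-actsAs l refl κ x | off x-off = trans (cong toℕ (rho-fixes-off-edges path-matching l x∉l)) (sym (act-fixes κ x-off))
    where
    x∉l : ¬ Any (onEdgeWithLabel (toℕ l) x) (pathEdges r h)
    x∉l x∈l with on-path x∈l
    ... | e , e:l , inj₁ x≡e   = proj₁ (x-off e e:l) x≡e
    ... | e , e:l , inj₂ x≡e+1 = proj₂ (x-off e e:l) x≡e+1

  -- Admissible permutations

  LabelIn : Subset r → ℕ → Set
  LabelIn I k = Σ (k < r) λ k<r → fromℕ< k<r ∈ₛ I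

  labelIn? : ∀ I k → Dec (LabelIn I k)
  labelIn? I k with k ℕ.<? r
  ... | no k≮r = no (k≮r ∘ proj₁)
  ... | yes k<r = Dec.map′ (k<r ,_) proj₂ (fromℕ< k<r ∈ₛ? I)

  LabelIn-toℕ : ∀ {I l} → l ∈ₛ I → LabelIn I (toℕ l)
  LabelIn-toℕ {I} {l} l∈I = Finₚ.toℕ<n l , subst (_∈ₛ I) (sym (Finₚ.fromℕ<-toℕ l (Finₚ.toℕ<n l))) l∈I

  EdgeIn : Subset r → ℕ → Set
  EdgeIn I e = LabelIn I (lab e)

  Linked : Subset r → ℕ → ℕ → Set
  Linked I x y = (∀ e → x ≤ e → e < y → EdgeIn I e) × (∀ e → y ≤ e → e < x → EdgeIn I e)

  -- The reflection v ↦ M ∸ v maps each edge e ≤ 2h onto the edge 2h ∸ e with the same label, while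
  -- the edge M (label h + 1) has no mirror image. Components that reach M, or that reach 0 while
  -- h + 1 ∈ I, therefore break the symmetry; on the remaining (coupled) vertices every element of
  -- ⟨ρ_i : i ∈ I⟩ commutes with the reflection.
  ReachesTop : Subset r → ℕ → Set
  ReachesTop I x = ∀ e → x ≤ e → e ≤ M → EdgeIn I e

  ReachesBottom : Subset r → ℕ → Set
  ReachesBottom I x = LabelIn I (suc h) × (∀ e → e < x → EdgeIn I e)

  Escapes : Subset r → ℕ → Set
  Escapes I x = ReachesTop I x ⊎ ReachesBottom I x

  Coupled : Subset r → ℕ → Set
  Coupled I x = x ≤ M × ¬ Escapes I x

  Admissible : Subset r → (Fin n → Fin n) → Set
  Admissible I g = (∀ x → Linked I (toℕ x) (toℕ (g x)))
                 × (∀ x y → Coupled I (toℕ x) → toℕ y ≡ M ∸ toℕ x → toℕ (g y) ≡ M ∸ toℕ (g x))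

  Linked-refl : ∀ {I} x → Linked I x x
  Linked-refl x = (λ e x≤e e<x → ⊥-elim (<⇒≱ e<x x≤e)) , (λ e x≤e e<x → ⊥-elim (<⇒≱ e<x x≤e))

  Linked-trans : ∀ {I x y z} → Linked I x y → Linked I y z → Linked I x z
  Linked-trans {I} {x} {y} {z} (x↗y , y↘x) (y↗z , z↘y) =
      (λ e x≤e e<z → [ x↗y e x≤e , (λ y≤e → y↗z e y≤e e<z) ]′ (<-≤-connex e y))
    , (λ e z≤e e<x → [ z↘y e z≤e , (λ y≤e → y↘x e y≤e e<x) ]′ (<-≤-connex e y))

  Linked-τ : ∀ {I e} → EdgeIn I e → ∀ v → Linked I v (τ e v)
  Linked-τ {I} {e} e∈I v with τ-view e v
  ... | at-left refl = subst (Linked I v) (sym (τ-left v))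
        ( (λ e′ v≤e′ e′<v+1 → subst (EdgeIn I) (≤-antisym v≤e′ (≤-pred e′<v+1)) e∈I)
        , (λ e′ v+1≤e′ e′<v → ⊥-elim (<⇒≱ (m<n⇒m<1+n e′<v) v+1≤e′)))
  ... | at-right refl = subst (Linked I (suc e)) (sym (τ-right e))
        ( (λ e′ e+1≤e′ e′<e → ⊥-elim (<⇒≱ (m<n⇒m<1+n e′<e) e+1≤e′))
        , (λ e′ e≤e′ e′<e+1 → subst (EdgeIn I) (≤-antisym e≤e′ (≤-pred e′<e+1)) e∈I))
  ... | elsewhere v≢e v≢e+1 = subst (Linked I v) (sym (τ-fixes v≢e v≢e+1)) (Linked-refl v)

  Escapes-Linked : ∀ {I x y} → Linked I x y → Escapes I y → Escapes I x
  Escapes-Linked {I} {x} {y} (x↗y , _) (inj₁ y→top) =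
    inj₁ (λ e x≤e e≤M → [ x↗y e x≤e , (λ y≤e → y→top e y≤e e≤M) ]′ (<-≤-connex e y))
  Escapes-Linked {I} {x} {y} (_ , y↘x) (inj₂ (h+1∈I , below-y)) =
    inj₂ (h+1∈I , λ e e<x → [ below-y e , (λ y≤e → y↘x e y≤e e<x) ]′ (<-≤-connex e y))

  Coupled-Linked : ∀ {I x y} → Linked I x y → Coupled I x → Coupled I y
  Coupled-Linked {I} {x} {y} x~y@(x↗y , _) (x≤M , x↛) = y≤M , x↛ ∘ Escapes-Linked x~y
    where
    y≤M : y ≤ M
    y≤M with y ℕ.≤? M
    ... | yes y≤M = y≤M
    ... | no  y≰M = ⊥-elim (x↛ (inj₁ (λ e x≤e e≤M → x↗y e x≤e (≤-<-trans e≤M (≰⇒> y≰M)))))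

  lab-M : lab M ≡ suc h
  lab-M = trans (cong lab (sym (+-suc h h))) (lab-h+ (suc h))

  act-linked : ∀ {I k} (κ : Kind k) → LabelIn I k → ∀ v → Linked I v (act κ v)
  act-linked {k = k} (single _) k∈I = Linked-τ (subst (LabelIn _) (sym (lab-h+ k)) k∈I)
  act-linked {k = k} (paired 1≤k k≤h) k∈I v =
    Linked-trans (Linked-τ (subst (LabelIn _) (sym lab-b) k∈I) v) (Linked-τ (subst (LabelIn _) (sym lab-a) k∈I) (τ b v))
    where open Paired 1≤k k≤h

  act-reflect : ∀ {I k v} (κ : Kind k) → LabelIn I k → Coupled I v → act κ (M ∸ v) ≡ M ∸ act κ v
  act-reflect {v = v} (single (inj₁ refl)) _ (v≤M , _) rewrite +-identityʳ h = τ-reflect h h v≤M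
  act-reflect {I} {k} {v} (single (inj₂ h<k)) k∈I (v≤M , v↛) with k ℕ.≟ suc h
  ... | yes refl = trans (τ-fixes-below (<-≤-trans M∸v<M M≤h+k)) (cong (M ∸_) (sym (τ-fixes-below (<-≤-trans v<M M≤h+k))))
    where
    M≤h+k : M ≤ h + suc h
    M≤h+k = ≤-reflexive (sym (+-suc h h))
    v<M : v < M
    v<M = ≤∧≢⇒< v≤M (λ { refl → v↛ (inj₁ (λ e M≤e e≤M →
            subst (EdgeIn I) (≤-antisym M≤e e≤M) (subst (LabelIn I) (sym lab-M) k∈I))) })
    M∸v<M : M ∸ v < M
    M∸v<M = ∸-monoʳ-< (n≢0⇒n>0 (λ { refl → v↛ (inj₂ (k∈I , λ _ ())) })) v≤M
  ... | no k≢h+1 = trans (τ-fixes-below (≤-<-trans (m∸n≤m M v) M<h+k)) (cong (M ∸_) (sym (τ-fixes-below (≤-<-trans v≤M M<h+k))))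
    where
    M<h+k : M < h + k
    M<h+k = subst (_< h + k) (+-suc h h) (+-monoʳ-< h (≤∧≢⇒< h<k (k≢h+1 ∘ sym)))
  act-reflect {I} {k} {v} (paired 1≤k k≤h) k∈I (v≤M , _) = begin
    τ a (τ b (M ∸ v))           ≡⟨ cong (λ m → τ a (τ b (m ∸ v))) M≡1+b+a ⟩
    τ a (τ b (suc (b + a) ∸ v)) ≡⟨ cong (τ a) (τ-reflect b a (≤-trans v≤M (≤-reflexive M≡1+b+a))) ⟩
    τ a (suc (b + a) ∸ τ a v)   ≡⟨ cong (λ m → τ a (m ∸ τ a v)) (trans (sym M≡1+b+a) M≡1+a+b) ⟩
    τ a (suc (a + b) ∸ τ a v)   ≡⟨ τ-reflect a b (≤-trans (τ-≤ v≤M (s≤s (≤-trans (<⇒≤ a<h) (m≤m+n h h)))) (≤-reflexive M≡1+a+b)) ⟩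
    suc (a + b) ∸ τ b (τ a v)   ≡⟨ cong₂ _∸_ (sym M≡1+a+b) (sym (τ-comm a+2≤b v)) ⟩
    M ∸ τ a (τ b v)             ∎
    where
    open ≡-Reasoning
    open Paired 1≤k k≤h
    M≡1+a+b : M ≡ suc (a + b)
    M≡1+a+b = cong suc (sym a+b≡h+h)
    M≡1+b+a : M ≡ suc (b + a)
    M≡1+b+a = trans M≡1+a+b (cong suc (+-comm a b))

  Admissible-id : ∀ I → Admissible I id
  Admissible-id I = (λ x → Linked-refl (toℕ x)) , (λ _ _ _ y≡M∸x → y≡M∸x)

  Admissible-∘ : ∀ {I f g} → Admissible I f → Admissible I g → Admissible I (f ∘ g)
  Admissible-∘ {g = g} (f-linked , f-reflect) (g-linked , g-reflect) =
      (λ x → Linked-trans (g-linked x) (f-linked (g x)))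
    , (λ x y x-coupled y≡M∸x → f-reflect (g x) (g y) (Coupled-Linked (g-linked x) x-coupled) (g-reflect x y x-coupled y≡M∸x))

  Admissible-cong : ∀ {I f g} → f ≈ g → Admissible I f → Admissible I g
  Admissible-cong {I} f≈g (f-linked , f-reflect) =
      (λ x → subst (Linked I (toℕ x) ∘ toℕ) (f≈g x) (f-linked x))
    , (λ x y x-coupled y≡M∸x → subst₂ (λ fy fx → toℕ fy ≡ M ∸ toℕ fx) (f≈g y) (f≈g x) (f-reflect x y x-coupled y≡M∸x))

  Admissible-ρ : ∀ {I} l → l ∈ₛ I → Admissible I (ρ l)
  Admissible-ρ {I} l l∈I =
      (λ x → subst (Linked I (toℕ x)) (sym (spec x)) (act-linked κ l∈I′ (toℕ x)))
    , (λ x y x-coupled y≡M∸x → begin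
        toℕ (ρ l y)           ≡⟨ spec y ⟩
        act κ (toℕ y)         ≡⟨ cong (act κ) y≡M∸x ⟩
        act κ (M ∸ toℕ x)     ≡⟨ act-reflect κ l∈I′ x-coupled ⟩
        M ∸ act κ (toℕ x)     ≡⟨ cong (M ∸_) (spec x) ⟨
        M ∸ toℕ (ρ l x)       ∎)
    where
    open ≡-Reasoning
    κ = kind (toℕ l)
    spec = ρ-actsAs l refl κ
    l∈I′ = LabelIn-toℕ l∈I

  Admissible-word : ∀ {I} w → All (_∈ₛ I) w → Admissible I (evalWord ρ w)
  Admissible-word {I} []      []           = Admissible-id I
  Admissible-word     (l ∷ w) (l∈I ∷ w∈I) = Admissible-∘ (Admissible-ρ l l∈I) (Admissible-word w w∈I)

  Admissible-InSub : ∀ {I g} → InSub ρ I g → Admissible I g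
  Admissible-InSub (w , w∈I , w≈g) = Admissible-cong w≈g (Admissible-word w w∈I)

  reachesTop? : ∀ I x → Dec (ReachesTop I x)
  reachesTop? I x = Dec.map′ (λ top e x≤e e≤M → top (s≤s e≤M) x≤e) (λ top {e} e<M+1 x≤e → top e x≤e (≤-pred e<M+1))
                      (allUpTo? (λ e → x ℕ.≤? e Dec.→-dec labelIn? I (lab e)) (suc M))

  reachesBottom? : ∀ I x → Dec (ReachesBottom I x)
  reachesBottom? I x = labelIn? I (suc h) Dec.×-dec Dec.map′ (λ below e → below {e}) (λ below {e} → below e)
                                                       (allUpTo? (λ e → labelIn? I (lab e)) x)

  reflect-bottom : ∀ {I v} → suc h ≤ v → ReachesBottom I v → ReachesTop I v
  reflect-bottom {I} {v} h<v (h+1∈I , below-v) e v≤e e≤M with m≤n⇒m<n∨m≡n e≤M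
  ... | inj₂ refl = subst (LabelIn I) (sym lab-M) h+1∈I
  ... | inj₁ e<M  = subst (LabelIn I) (lab-reflect (≤-pred e<M)) (below-v (h + h ∸ e) 2h∸e<v)
    where
    2h∸e<v : h + h ∸ e < v
    2h∸e<v = m<n+o⇒m∸n<o (h + h) e {{>-nonZero (<-≤-trans z<s h<v)}}
               (<-≤-trans (+-monoʳ-< h (n<1+n h)) (≤-trans (+-monoˡ-≤ (suc h) (m≤n+m h 1)) (+-mono-≤ (≤-trans h<v v≤e) h<v)))

  reflect-top : ∀ {I v} → v ≤ h → ReachesTop I v → ReachesBottom I v
  reflect-top {I} {v} v≤h top =
      subst (LabelIn I) lab-M (top M (≤-trans v≤h (≤-trans (m≤m+n h h) (n≤1+n _))) ≤-refl)
    , λ e e<v → subst (LabelIn I) (lab-reflect (e≤2h e<v))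
                  (top (h + h ∸ e) (v≤2h∸e e<v) (≤-trans (m∸n≤m (h + h) e) (n≤1+n _)))
    where
    e≤2h : ∀ {e} → e < v → e ≤ h + h
    e≤2h e<v = ≤-trans (<⇒≤ (<-≤-trans e<v v≤h)) (m≤m+n h h)
    v≤2h∸e : ∀ {e} → e < v → v ≤ h + h ∸ e
    v≤2h∸e e<v = m+n≤o⇒m≤o∸n v (+-mono-≤ v≤h (<⇒≤ (<-≤-trans e<v v≤h)))

  LabelIn-∩ : ∀ {I J k} → LabelIn I k → LabelIn J k → LabelIn (I ∩ J) k
  LabelIn-∩ (k<r , k∈I) (_ , k∈J) = k<r , x∈p∩q⁺ (k∈I , k∈J)

  Escapes-∩ : ∀ {I J v} → Escapes I v → Escapes J v → Escapes (I ∩ J) v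
  Escapes-∩ (inj₁ topI) (inj₁ topJ) = inj₁ (λ e v≤e e≤M → LabelIn-∩ (topI e v≤e e≤M) (topJ e v≤e e≤M))
  Escapes-∩ (inj₂ (h+1∈I , belowI)) (inj₂ (h+1∈J , belowJ)) =
    inj₂ (LabelIn-∩ h+1∈I h+1∈J , λ e e<v → LabelIn-∩ (belowI e e<v) (belowJ e e<v))
  Escapes-∩ {v = v} (inj₁ topI) (inj₂ botJ) with v ℕ.≤? h
  ... | yes v≤h = Escapes-∩ (inj₂ (reflect-top v≤h topI)) (inj₂ botJ)
  ... | no  v≰h = Escapes-∩ (inj₁ topI) (inj₁ (reflect-bottom (≰⇒> v≰h) botJ))
  Escapes-∩ {v = v} (inj₂ botI) (inj₁ topJ) with v ℕ.≤? h
  ... | yes v≤h = Escapes-∩ (inj₂ botI) (inj₂ (reflect-top v≤h topJ))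
  ... | no  v≰h = Escapes-∩ (inj₁ (reflect-bottom (≰⇒> v≰h) botI)) (inj₁ topJ)

  Coupled-∩ : ∀ {I J v} → Coupled (I ∩ J) v → Coupled I v ⊎ Coupled J v
  Coupled-∩ {I} {J} {v} (v≤M , v↛) with reachesTop? I v Dec.⊎-dec reachesBottom? I v | reachesTop? J v Dec.⊎-dec reachesBottom? J v
  ... | no  v↛I | _        = inj₁ (v≤M , v↛I)
  ... | yes _   | no  v↛J = inj₂ (v≤M , v↛J)
  ... | yes v→I | yes v→J = ⊥-elim (v↛ (Escapes-∩ v→I v→J))

  Admissible-∩ : ∀ {I J g} → Admissible I g → Admissible J g → Admissible (I ∩ J) g
  Admissible-∩ (I-linked , I-reflect) (J-linked , J-reflect) =
      (λ x → let (x↗I , x↘I) = I-linked x ; (x↗J , x↘J) = J-linked x in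
               (λ e p q → LabelIn-∩ (x↗I e p q) (x↗J e p q)) , (λ e p q → LabelIn-∩ (x↘I e p q) (x↘J e p q)))
    , (λ x y x-coupled y≡M∸x → [ (λ x-coupledI → I-reflect x y x-coupledI y≡M∸x) , (λ x-coupledJ → J-reflect x y x-coupledJ y≡M∸x) ]′
                                 (Coupled-∩ x-coupled))

  Admissible-full : ∀ g → Admissible full g
  Admissible-full g =
      (λ x → (λ e _ e<gx → edge∈full (<-≤-trans e<gx (below-N (g x)))) , (λ e _ e<x → edge∈full (<-≤-trans e<x (below-N x))))
    , (λ x _ (_ , x↛) _ → ⊥-elim (x↛ (inj₁ (λ e _ e≤M → edge∈full (≤-<-trans e≤M M<N)))))
    where
    below-N : ∀ (x : Fin n) → toℕ x ≤ N
    below-N x = ≤-pred (Finₚ.toℕ<n x)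
    edge∈full : ∀ {e} → e < N → EdgeIn full e
    edge∈full e<N = lab<r e<N , ∈⊤

  record Realises (I : Subset r) (S : ℕ → ℕ) : Set where
    constructor realisedBy
    field
      word   : List (Fin r)
      word∈I : All (_∈ₛ I) word
      word-actsAs : ActsAs (evalWord ρ word) S

  Realises-∘ : ∀ {I S T} → Realises I S → Realises I T → Realises I (S ∘ T)
  Realises-∘ {S = S} (realisedBy w w∈I w~S) (realisedBy v v∈I v~T) =
    realisedBy (w ++ v) (Allₚ.++⁺ w∈I v∈I) λ x → trans (cong toℕ (evalWord-++ ρ w v x)) (trans (w~S _) (cong S (v~T x)))

  Realises-cong : ∀ {I S T} → (∀ v → S v ≡ T v) → Realises I S → Realises I T
  Realises-cong S≗T (realisedBy w w∈I w~S) = realisedBy w w∈I λ x → trans (w~S x) (S≗T _)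

  Realises-act : ∀ {I k} → LabelIn I k → (κ : Kind k) → Realises I (act κ)
  Realises-act (k<r , k∈I) κ = realisedBy (fromℕ< k<r ∷ []) (k∈I ∷ []) (ρ-actsAs (fromℕ< k<r) (Finₚ.toℕ-fromℕ< k<r) κ)

  free-left : ∀ {I k} (1≤k : 1 ≤ k) (k≤h : k ≤ h) → LabelIn I k → Realises I (τ (suc (h + k))) → Realises I (τ (h ∸ k))
  free-left {I} 1≤k k≤h k∈I τ[b+1] = Realises-cong (τ-braid-cube a+2≤b) (Realises-∘ t (Realises-∘ t t))
    where
    open Paired 1≤k k≤h
    t : Realises I (λ u → τ a (τ b (τ (suc b) u)))
    t = Realises-∘ (Realises-act k∈I (paired 1≤k k≤h)) τ[b+1]

  LabelsFrom : Subset r → ℕ → Set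
  LabelsFrom I k = ∀ j → k ≤ j → j ≤ suc h → LabelIn I j

  free-right : ∀ {I} t k → k + t ≡ suc h → 1 ≤ k → LabelsFrom I k → Realises I (τ (h + k))
  free-right zero k k+0≡h+1 _ from-k = Realises-act (from-k k ≤-refl k≤h+1) (single (inj₂ h<k))
    where
    k≤h+1 : k ≤ suc h
    k≤h+1 = ≤-reflexive (trans (sym (+-identityʳ k)) k+0≡h+1)
    h<k : h < k
    h<k = ≤-reflexive (sym (trans (sym (+-identityʳ k)) k+0≡h+1))
  free-right {I} (suc t) k k+t+1≡h+1 1≤k from-k =
    Realises-cong (λ v → τ-involutive (h ∸ k) (τ (h + k) v))
      (Realises-∘ (free-left 1≤k k≤h k∈I τ[b+1]) (Realises-act k∈I (paired 1≤k k≤h)))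
    where
    1+k+t≡h+1 : suc k + t ≡ suc h
    1+k+t≡h+1 = trans (sym (+-suc k t)) k+t+1≡h+1
    k≤h : k ≤ h
    k≤h = ≤-pred (≤-trans (m≤m+n (suc k) t) (≤-reflexive 1+k+t≡h+1))
    k∈I : LabelIn I k
    k∈I = from-k k ≤-refl (m≤n⇒m≤1+n k≤h)
    τ[b+1] : Realises I (τ (suc (h + k)))
    τ[b+1] = subst (Realises I ∘ τ) (+-suc h k)
               (free-right t (suc k) 1+k+t≡h+1 (s≤s z≤n) (λ j k<j j≤h+1 → from-k j (<⇒≤ k<j) j≤h+1))

  free-paired : ∀ {I k} (1≤k : 1 ≤ k) (k≤h : k ≤ h) → LabelsFrom I k → Realises I (τ (h ∸ k)) × Realises I (τ (h + k))
  free-paired {I} {k} 1≤k k≤h from-k =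
      free-left 1≤k k≤h (from-k k ≤-refl (m≤n⇒m≤1+n k≤h))
        (subst (Realises I ∘ τ) (+-suc h k)
          (free-right (h ∸ k) (suc k) (cong suc (m+[n∸m]≡n k≤h)) (s≤s z≤n) (λ j k<j → from-k j (<⇒≤ k<j))))
    , free-right (suc h ∸ k) k (m+[n∸m]≡n (m≤n⇒m≤1+n k≤h)) 1≤k from-k

  -- toFin v is junk (zero) for v ≥ n.
  opaque
    toFin : ℕ → Fin n
    toFin v with v ℕ.<? n
    ... | yes v<n = fromℕ< v<n
    ... | no  _   = Fin.zero

    toℕ-toFin : ∀ {v} → v < n → toℕ (toFin v) ≡ v
    toℕ-toFin {v} v<n with v ℕ.<? n
    ... | yes _   = Finₚ.toℕ-fromℕ< _
    ... | no  v≮n = ⊥-elim (v≮n v<n)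

  toFin-toℕ : ∀ x → toFin (toℕ x) ≡ x
  toFin-toℕ x = Finₚ.toℕ-injective (toℕ-toFin (Finₚ.toℕ<n x))

  onℕ : (Fin n → Fin n) → ℕ → ℕ
  onℕ g v = toℕ (g (toFin v))

  module _ {I : Subset r} {g : Fin n → Fin n} where

    onℕ-linked : (∀ x → Linked I (toℕ x) (toℕ (g x))) → ∀ {v} → v < n → Linked I v (onℕ g v)
    onℕ-linked linked {v} v<n = subst (λ u → Linked I u (onℕ g v)) (toℕ-toFin v<n) (linked (toFin v))

    onℕ-reflect : Admissible I g → ∀ {v} → v < n → Coupled I v → onℕ g (M ∸ v) ≡ M ∸ onℕ g v
    onℕ-reflect (_ , reflect) {v} v<n v-coupled =
      reflect (toFin v) (toFin (M ∸ v)) (subst (Coupled I) (sym (toℕ-toFin v<n)) v-coupled)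
        (trans (toℕ-toFin (≤-<-trans (m∸n≤m M v) (m<n⇒m<1+n M<N))) (cong (M ∸_) (sym (toℕ-toFin v<n))))

    onℕ-injective : Injective _≡_ _≡_ g → ∀ {u v} → u < n → v < n → onℕ g u ≡ onℕ g v → u ≡ v
    onℕ-injective g-inj {u} {v} u<n v<n gu≡gv =
      trans (sym (toℕ-toFin u<n)) (trans (cong toℕ (g-inj (Finₚ.toℕ-injective gu≡gv))) (toℕ-toFin v<n))

    no-descent⇒id : Injective _≡_ _≡_ g → (∀ x → Linked I (toℕ x) (toℕ (g x))) →
                    (∀ e → e < N → EdgeIn I e → ¬ onℕ g (suc e) < onℕ g e) → g ≈ id
    no-descent⇒id g-inj linked ascending x = Finₚ.toℕ-injective (begin-equality
      toℕ (g x)          ≡⟨ cong (toℕ ∘ g) (toFin-toℕ x) ⟨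
      onℕ g (toℕ x)      ≡⟨ ≤-antisym (Gv≤v (N ∸ toℕ x) (toℕ x) (m+[n∸m]≡n (≤-pred (Finₚ.toℕ<n x))))
                                      (v≤Gv (toℕ x) (Finₚ.toℕ<n x)) ⟩
      toℕ x              ∎)
      where
      open ≤-Reasoning
      G = onℕ g
      increasing : ∀ {e} → suc e < n → EdgeIn I e → G e < G (suc e)
      increasing e+1<n e∈I = ≤∧≢⇒< (≮⇒≥ (ascending _ (≤-pred e+1<n) e∈I))
                                    (λ Ge≡Ge+1 → 1+n≢n (sym (onℕ-injective g-inj (<-trans (n<1+n _) e+1<n) e+1<n Ge≡Ge+1)))
      v≤Gv : ∀ v → v < n → v ≤ G v
      v≤Gv zero    _     = z≤n
      v≤Gv (suc u) u+1<n with labelIn? I (lab u)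
      ... | yes u∈I = ≤-trans (s≤s (v≤Gv u (<-trans (n<1+n u) u+1<n))) (increasing u+1<n u∈I)
      ... | no  u∉I = ≮⇒≥ (λ Gu+1≤u → u∉I (proj₂ (onℕ-linked linked u+1<n) u (≤-pred Gu+1≤u) ≤-refl))
      Gv≤v : ∀ t v → v + t ≡ N → G v ≤ v
      Gv≤v zero v v+0≡N =
        ≤-pred (≤-trans (Finₚ.toℕ<n (g (toFin v))) (≤-reflexive (cong suc (sym (trans (sym (+-identityʳ v)) v+0≡N)))))
      Gv≤v (suc t) v v+t+1≡N with labelIn? I (lab v)
      ... | yes v∈I = ≤-pred (≤-trans (increasing v+1<n v∈I) (Gv≤v t (suc v) (trans (sym (+-suc v t)) v+t+1≡N)))
        where
        v+1<n : suc v < n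
        v+1<n = s≤s (≤-trans (m≤m+n (suc v) t) (≤-reflexive (trans (sym (+-suc v t)) v+t+1≡N)))
      ... | no  v∉I = ≮⇒≥ (λ v<Gv → v∉I (proj₁ (onℕ-linked linked v<n) v ≤-refl v<Gv))
        where
        v<n : v < n
        v<n = s≤s (≤-trans (m≤m+n v (suc t)) (≤-reflexive v+t+1≡N))

  coupled-inside : ∀ {I k j x} → k < j → j ≤ suc h → ¬ LabelIn I j → h ∸ k ≤ x → x ≤ suc (h + k) → Coupled I x
  coupled-inside {I} {k} {j} {x} k<j j≤h+1 j∉I a≤x x≤b+1 = x≤M , x↛
    where
    k≤h : k ≤ h
    k≤h = ≤-pred (<-≤-trans k<j j≤h+1)
    x≤M : x ≤ M
    x≤M = ≤-trans x≤b+1 (s≤s (+-monoʳ-≤ h k≤h))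
    x↛ : ¬ Escapes I x
    x↛ (inj₁ top) = j∉I (subst (LabelIn I) (lab-h+ j) (top (h + j) x≤h+j h+j≤M))
      where
      x≤h+j = ≤-trans x≤b+1 (≤-trans (≤-reflexive (sym (+-suc h k))) (+-monoʳ-≤ h k<j))
      h+j≤M = ≤-trans (+-monoʳ-≤ h j≤h+1) (≤-reflexive (+-suc h h))
    x↛ (inj₂ (h+1∈I , below)) with m≤n⇒m<n∨m≡n j≤h+1
    ... | inj₂ refl = j∉I h+1∈I
    ... | inj₁ j≤h  = j∉I (subst (LabelIn I) (lab-∸ (≤-pred j≤h)) (below (h ∸ j) (<-≤-trans (∸-monoʳ-< k<j (≤-pred j≤h)) a≤x)))

  Improvement : Subset r → (ℕ → ℕ) → Set
  Improvement I G = Σ (ℕ → ℕ) λ S → Realises I S × weight n G < weight n (G ∘ S)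

  module _ {I : Subset r} {g : Fin n → Fin n} (adm : Admissible I g) where

    private
      G = onℕ g

    reflect-descent : ∀ {e} → Coupled I e → Coupled I (suc e) → e ≤ h + h → suc e < n →
                      G (suc e) < G e → G (suc (h + h ∸ e)) < G (h + h ∸ e)
    reflect-descent {e} e-coupled e+1-coupled e≤2h e+1<n descent = begin-strict
      G (suc (h + h ∸ e)) ≡⟨ cong G (+-∸-assoc 1 e≤2h) ⟨
      G (M ∸ e)           ≡⟨ onℕ-reflect adm e<n e-coupled ⟩
      M ∸ G e             <⟨ ∸-monoʳ-< descent (proj₁ (Coupled-Linked (onℕ-linked (proj₁ adm) e<n) e-coupled)) ⟩
      M ∸ G (suc e)       ≡⟨ onℕ-reflect adm e+1<n e+1-coupled ⟨
      G (h + h ∸ e)       ∎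
      where
      open ≤-Reasoning
      e<n = <-trans (n<1+n e) e+1<n

    improve-paired : ∀ {e k} (1≤k : 1 ≤ k) (k≤h : k ≤ h) → lab e ≡ k → LabelIn I k → e < N → G (suc e) < G e →
                     ∀ {j} → k < j → j ≤ suc h → ¬ LabelIn I j → Improvement I G
    improve-paired {e} {k} 1≤k k≤h e:k k∈I e<N descent k<j j≤h+1 j∉I =
        act (paired 1≤k k≤h)
      , Realises-act k∈I (paired 1≤k k≤h)
      , <-trans (weight-τ n G a a+1<n a-descent) (weight-τ n (G ∘ τ a) b b+1<n b-descent′)
      where
      open Paired 1≤k k≤h
      b+1<n : suc b < n
      b+1<n = s≤s (h+k<N (<-trans (s≤s k≤h) h+2≤r))
      a+1<n : suc a < n
      a+1<n = <-trans a+2≤b (<-trans (n<1+n b) b+1<n)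
      coupled : ∀ {x} → a ≤ x → x ≤ suc b → Coupled I x
      coupled = coupled-inside k<j j≤h+1 j∉I
      reflect : ∀ {x} → a ≤ x → x ≤ b → suc x < n → G (suc x) < G x → G (suc (h + h ∸ x)) < G (h + h ∸ x)
      reflect a≤x x≤b x+1<n = reflect-descent (coupled a≤x (m≤n⇒m≤1+n x≤b)) (coupled (m≤n⇒m≤1+n a≤x) (s≤s x≤b))
                                (≤-trans x≤b (+-monoʳ-≤ h k≤h)) x+1<n
      a≤b : a ≤ b
      a≤b = <⇒≤ (<-trans (n<1+n a) a+2≤b)
      descents : G (suc a) < G a × G (suc b) < G b
      descents with edges {e} e:k
      ... | inj₁ refl = subst (λ x → G (suc x) < G x) ([m+n]∸[m+o]≡n∸o h h k) (reflect a≤b ≤-refl b+1<n descent) , descent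
      ... | inj₂ refl = descent , subst (λ x → G (suc x) < G x) (trans (cong (_∸ a) (sym a+b≡h+h)) (m+n∸m≡n a b))
                                        (reflect ≤-refl a≤b a+1<n descent)
      a-descent = proj₁ descents
      b-descent′ : G (τ a (suc b)) < G (τ a b)
      b-descent′ = subst₂ _<_ (cong G (sym (τ-fixes-above (<-trans (n<1+n _) (s≤s a+2≤b)))))
                              (cong G (sym (τ-fixes-above a+2≤b))) (proj₂ descents)

    improve : ∀ {e} → e < N → EdgeIn I e → G (suc e) < G e → Improvement I G
    improve {e} e<N e∈I descent with kind (lab e)
    ... | single s = τ (h + lab e) , Realises-act e∈I (single s)
                   , subst (λ x → weight n G < weight n (G ∘ τ x)) (single-edge s refl) (weight-τ n G e (s≤s e<N) descent)
    ... | paired 1≤k k≤h with anyUpTo? (λ j → lab e ℕ.<? j Dec.×-dec Dec.¬? (labelIn? I j)) (suc (suc h))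
    ...   | yes (j , j<h+2 , k<j , j∉I) = improve-paired 1≤k k≤h refl e∈I e<N descent k<j (≤-pred j<h+2) j∉I
    ...   | no  no-gap = τ e , realisation , weight-τ n G e (s≤s e<N) descent
      where
      open Paired 1≤k k≤h
      from-k : LabelsFrom I (lab e)
      from-k j k≤j j≤h+1 with m≤n⇒m<n∨m≡n k≤j
      ... | inj₂ refl = e∈I
      ... | inj₁ k<j  = Dec.decidable-stable (labelIn? I j) (λ j∉I → no-gap (j , s≤s j≤h+1 , k<j , j∉I))
      realisation : Realises I (τ e)
      realisation with edges {e} refl
      ... | inj₁ e≡b = subst (Realises I ∘ τ) (sym e≡b) (proj₂ (free-paired 1≤k k≤h from-k))
      ... | inj₂ e≡a = subst (Realises I ∘ τ) (sym e≡a) (proj₁ (free-paired 1≤k k≤h from-k))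

  weight-bound : ∀ g → weight n (onℕ g) ≤ n * (n * n)
  weight-bound g = sumBelow-≤ n (λ v v<n → *-mono-≤ (<⇒≤ v<n) (<⇒≤ (Finₚ.toℕ<n (g (toFin v)))))

  improvable : ∀ {I g} → Injective _≡_ _≡_ g → Admissible I g →
               g ≈ id ⊎ Σ (List (Fin r)) λ w → All (_∈ₛ I) w × weight n (onℕ g) < weight n (onℕ (g ∘ evalWord ρ w))
  improvable {I} {g} g-inj adm with anyUpTo? (λ e → labelIn? I (lab e) Dec.×-dec onℕ g (suc e) ℕ.<? onℕ g e) N
  ... | no no-descent = inj₁ (no-descent⇒id g-inj (proj₁ adm) (λ e e<N e∈I descent → no-descent (e , e<N , e∈I , descent)))
  ... | yes (e , e<N , e∈I , descent) with improve adm e<N e∈I descent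
  ...   | S , realisedBy w w∈I w~S , increase = inj₂ (w , w∈I , subst (weight n (onℕ g) <_) (sym weight≡) increase)
    where
    w≡S : ∀ {v} → v < n → evalWord ρ w (toFin v) ≡ toFin (S v)
    w≡S {v} v<n = sym (trans (cong (toFin ∘ S) (sym (toℕ-toFin v<n))) (trans (cong toFin (sym (w~S (toFin v)))) (toFin-toℕ _)))
    weight≡ : weight n (onℕ (g ∘ evalWord ρ w)) ≡ weight n (onℕ g ∘ S)
    weight≡ = sumBelow-cong n (λ v v<n → cong (λ x → v * toℕ (g x)) (w≡S v<n))

  complete-within : ∀ {I} t g → Injective _≡_ _≡_ g → Admissible I g → n * (n * n) ≤ weight n (onℕ g) + t → InSub ρ I g
  complete-within t g g-inj adm bound with improvable g-inj adm | t
  ... | inj₁ g≈id | _ = [] , [] , λ x → sym (g≈id x)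
  ... | inj₂ (w , w∈I , increase) | zero =
    ⊥-elim (<⇒≱ (<-≤-trans increase (weight-bound (g ∘ evalWord ρ w))) (≤-trans bound (≤-reflexive (+-identityʳ _))))
  ... | inj₂ (w , w∈I , increase) | suc t =
    InSub-cancelʳ ρ ρ-involutive w w∈I
      (complete-within t (g ∘ evalWord ρ w) (evalWord-injective ρ ρ-involutive w ∘ g-inj)
        (Admissible-∘ adm (Admissible-word w w∈I)) (≤-trans bound (≤-trans (≤-reflexive (+-suc _ t)) (+-monoˡ-≤ t increase))))

  complete : ∀ {I} g → Injective _≡_ _≡_ g → Admissible I g → InSub ρ I g
  complete g g-inj adm = complete-within _ g g-inj adm (m≤n+m _ _)

  ρ-isStringCGroup : IsStringCGroup ρ
  ρ-isStringCGroup = ρ-isInvolution , ρ-far-commute , λ I J g → intersection I J g , restriction I J g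
    where
    intersection : ∀ I J g → InSub ρ I g × InSub ρ J g → InSub ρ (I ∩ J) g
    intersection I J g (g∈I , g∈J) =
      complete g (InSub-injective ρ ρ-involutive g∈I) (Admissible-∩ (Admissible-InSub g∈I) (Admissible-InSub g∈J))
    restriction : ∀ I J g → InSub ρ (I ∩ J) g → InSub ρ I g × InSub ρ J g
    restriction I J g (w , w∈I∩J , w≈g) = (w , All.map (proj₁ ∘ x∈p∩q⁻ I J) w∈I∩J , w≈g)
                                         , (w , All.map (proj₂ ∘ x∈p∩q⁻ I J) w∈I∩J , w≈g)

  ρ-isoToSym : IsoToSym ρ n
  ρ-isoToSym = (λ σ → σ ⟨$⟩ʳ_)
             , (λ σ → complete _ (Injection.injective (↔⇒↣ σ)) (Admissible-full _))
             , (λ _ _ _ → refl)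
             , (λ _ _ σ≈τ → σ≈τ)
             , λ g (w , _ , w≈g) → permutation (evalWord ρ w) (evalWord ρ (reverse w))
                                     (evalWord-reverse-inverseʳ ρ ρ-involutive w) (evalWord-reverse-inverseˡ ρ ρ-involutive w)
                                 , w≈g

proposition4p7 : (r h : ℕ) → 3 ≤ r → 1 ≤ h → h ≤ r ∸ 2 →
    IsCPRGraph (suc (r + h)) r (pathEdges r h)
    × IsoToSym {suc (r + h)} {r} (rho (pathEdges r h)) (suc (r + h))
proposition4p7 r h (s≤s (s≤s (s≤s _))) _ h≤r∸2 = (path-isLabelledGraph , ρ-isStringCGroup) , ρ-isoToSym
  where open Path r h (s≤s (s≤s h≤r∸2))
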